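{- Let $a_1,\dots,a_n$ be positive integers with $\gcd(a_1,\dots,a_n)=1$ whose sum $m>1$ is odd, let $P=(a_1/m,\dots,a_n/m)$, and let $\ell$ be the multiplicative order of $2$ modulo $m$. Then $\mathrm{ALDR}[P,\ell]$ is an entropy-optimal DDG tree for $P$.
   Context: All logarithms are base 2. For real $x\ge0$ and integer $d$, $\epsilon_d(x)=\lfloor2^dx\rfloor\bmod2$. A DDG tree is a sampler driven by i.i.d. fair bits: a binary tree (possibly with back edges to the root) with labeled leaves traversed from the root one fair bit per step until a leaf is reached, whose label is output. A DDG tree with output distribution $P$ is entropy optimal if its expected number of consumed bits is minimal among all DDG trees with output distribution $P$ (equivalently, after unrolling back edges, it has exactly $\epsilon_d(p_i)$ leaves labeled $i$ at depth $d$). FLDR: for positive integers $A_1,\dots,A_n$ with sum $M$, $K'=\lceil\log M\rceil$, $A_0=2^{K'}-M$, $Q=(A_0/2^{K'},\dots,A_n/2^{K'})$; $\mathrm{FLDR}[A_1,\dots,A_n]$ is an entropy-optimal DDG tree for $Q$ with each leaf labeled $0$ replaced by a back edge to the root; its output distribution is $(A_i/M)$. ALDR: for integer $K\ge\lceil\log m\rceil$, $c_K=\lfloor2^K/m\rfloor$ and $\mathrm{ALDR}[P,K]=\mathrm{FLDR}[c_Ka_1,\dots,c_Ka_n]$ (note $\ell\ge\lceil\log m\rceil$ since $m<2^\ell$). -}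

module Defs where

open import Data.Nat using (ℕ; zero; suc; _+_; _*_; _∸_; _^_; _≤_; _<_; NonZero)
open import Data.Nat.DivMod using (_/_; _%_)
open import Data.Nat.GCD using (gcd)
open import Data.Nat.Logarithm using (⌈log₂_⌉)
open import Data.Nat.Properties using (m^n≢0)
open import Data.Fin using (Fin; zero; suc)
open import Data.Product using (Σ; _×_)
open import Relation.Binary.PropositionalEquality using (_≡_; _≢_)
open import Relation.Nullary using (¬_; does)
open import Data.Bool using (if_then_else_)
open import Data.Fin.Properties using () renaming (_≟_ to _≟ᶠ_)

sumF : (n : ℕ) → (Fin n → ℕ) → ℕ
sumF zero    f = 0
sumF (suc n) f = f zero + sumF n (λ i → f (suc i))

gcdF : (n : ℕ) → (Fin n → ℕ) → ℕ
gcdF zero    f = 0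
gcdF (suc n) f = gcd (f zero) (gcdF n (λ i → f (suc i)))

ε : ℕ → (x b : ℕ) → .{{NonZero b}} → ℕ
ε d x b = ((2 ^ d * x) / b) % 2

IsMultOrder2 : (m ℓ : ℕ) → Set
IsMultOrder2 m ℓ =
  (1 ≤ ℓ) × ((2 ^ ℓ) % (suc (m ∸ 1)) ≡ 1 % suc (m ∸ 1))
          × (∀ k → 1 ≤ k → k < ℓ → ¬ ((2 ^ k) % suc (m ∸ 1) ≡ 1 % suc (m ∸ 1)))
-- (m is ≥ 2 wherever this is used, so suc (m ∸ 1) = m)

-- DDG trees with labels in L: leaves, back edges to the root, binary nodes
data Tree (L : Set) : Set where
  leaf : L → Tree L
  back : Tree L
  node : Tree L → Tree L → Tree L

-- number of leaves labeled i at depth d in the unrolling of the tree with root r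
-- walk r t d : leaves labeled i at depth d below subtree t (a back edge restarts at r)
mutual
  walk : ∀ {n} → Tree (Fin n) → Tree (Fin n) → ℕ → Fin n → ℕ
  walk r (leaf j)   zero    i = if does (j ≟ᶠ i) then 1 else 0
  walk r (leaf j)   (suc d) i = 0
  walk r back       d       i = restart r r d i
  walk r (node a b) zero    i = 0
  walk r (node a b) (suc d) i = walk r a d i + walk r b d i

  -- restart r s d : walk from the root r (s is r, recursed structurally);
  -- a back edge at the root itself is a degenerate loop with no leaves
  restart : ∀ {n} → Tree (Fin n) → Tree (Fin n) → ℕ → Fin n → ℕ
  restart r (leaf j)   zero    i = if does (j ≟ᶠ i) then 1 else 0
  restart r (leaf j)   (suc d) i = 0
  restart r back       d       i = 0
  restart r (node a b) zero    i = 0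
  restart r (node a b) (suc d) i = walk r a d i + walk r b d i

leaves : ∀ {n} → Tree (Fin n) → ℕ → Fin n → ℕ
leaves t d i = restart t t d i

EntropyOptimal : ∀ {n} → Tree (Fin n) → (x : Fin n → ℕ) → (b : ℕ) → .{{NonZero b}} → Set
EntropyOptimal t x b = ∀ d i → leaves t d i ≡ ε d (x i) b

dropZero : ∀ {n} → Tree (Fin (suc n)) → Tree (Fin n)
dropZero (leaf zero)    = back
dropZero (leaf (suc i)) = leaf i
dropZero back           = back
dropZero (node a b)     = node (dropZero a) (dropZero b)

fldrM : ∀ n → (Fin n → ℕ) → ℕ
fldrM n A = sumF n A

fldrK : ∀ n → (Fin n → ℕ) → ℕ
fldrK n A = ⌈log₂ fldrM n A ⌉

fldrQ : ∀ n → (Fin n → ℕ) → Fin (suc n) → ℕ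
fldrQ n A zero    = 2 ^ fldrK n A ∸ fldrM n A
fldrQ n A (suc i) = A i

IsFLDR : ∀ n → (Fin n → ℕ) → Tree (Fin n) → Set
IsFLDR n A t = Σ (Tree (Fin (suc n))) λ u →
  EntropyOptimal u (fldrQ n A) (2 ^ fldrK n A) {{m^n≢0 2 (fldrK n A)}} × (t ≡ dropZero u)

IsALDR : ∀ n → (a : Fin n → ℕ) → (K : ℕ) → Tree (Fin n) → Set
IsALDR n a K t = IsFLDR n (λ i → (2 ^ K / suc (sumF n a ∸ 1)) * a i) t
-- (m ≥ 1 wherever this is used, so suc (m ∸ 1) = m)

-- Since 2^ℓ ≡ 1 (mod m), ALDR[P, ℓ] is FLDR[c a₁, …, c aₙ] with c = (2^ℓ − 1)/m, so its
-- target Q has denominator 2^ℓ and a single rejection leaf, at depth ℓ. Replacing that leaf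
-- by a back edge makes the leaf counts of the sampler satisfy the renewal equation
-- L(d) = U(d) + L(d − ℓ), where U(d) is the d-th binary digit of c aᵢ/2^ℓ. The binary
-- expansion of aᵢ/m = c aᵢ/(2^ℓ − 1) is the ℓ-digit block of c aᵢ/2^ℓ repeated forever,
-- so the digits of aᵢ/m satisfy the same renewal equation, whose solution is unique.
module Submission where

open import Defs
open import Data.Nat using (ℕ; _≤_; _<_; s≤s; z≤n; >-nonZero)
open import Data.Nat.DivMod using (_%_)
open import Data.Nat.Properties using (<-trans)
open import Data.Fin using (Fin)
open import Relation.Binary.PropositionalEquality using (_≡_)

open import Data.Fin using (zero; suc)
open import Data.Nat using (zero; suc; _+_; _*_; _∸_; _^_; NonZero; _<?_; ⌊_/2⌋; ⌈_/2⌉; s≤s⁻¹)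
open import Data.Nat.DivMod
open import Data.Nat.GCD using (gcd-identityʳ)
open import Data.Nat.Divisibility using (n∣m*n)
open import Data.Nat.Induction using (<-rec)
open import Data.Nat.Logarithm using (⌈log₂_⌉; ⌈log₂⌉-mono-≤; ⌈log₂2^n⌉≡n; ⌈log₂⌈n/2⌉⌉≡⌈log₂n⌉∸1)
open import Data.Nat.Properties
open import Algebra.Properties.CommutativeSemigroup +-commutativeSemigroup using (interchange)
open import Algebra.Properties.CommutativeSemigroup *-commutativeSemigroup using (x∙yz≈y∙xz)
open import Data.Nat.Tactic.RingSolver using (solve-∀)
open import Data.Product using (_,_)
open import Function using (_∘_)
open import Relation.Binary.PropositionalEquality using (refl; sym; trans; cong; cong₂; subst; module ≡-Reasoning)
open import Relation.Nullary using (yes; no; contradiction)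

δ : ℕ → ℕ → ℕ
δ zero    zero    = 1
δ zero    (suc e) = 0
δ (suc k) zero    = 0
δ (suc k) (suc e) = δ k e

δ-< : ∀ {k e} → e < k → δ k e ≡ 0
δ-< {suc k} {zero}  _         = refl
δ-< {suc k} {suc e} (s≤s e<k) = δ-< e<k

infixl 7 _⋆_

_⋆_ : (ℕ → ℕ) → (ℕ → ℕ) → ℕ → ℕ
(f ⋆ g) zero    = f 0 * g 0
(f ⋆ g) (suc d) = f 0 * g (suc d) + (f ∘ suc ⋆ g) d

⋆-congˡ : ∀ {f f′ : ℕ → ℕ} g → (∀ e → f e ≡ f′ e) → ∀ d → (f ⋆ g) d ≡ (f′ ⋆ g) d
⋆-congˡ g f≗f′ zero    = cong (_* g 0) (f≗f′ 0)
⋆-congˡ g f≗f′ (suc d) = cong₂ _+_ (cong (_* g (suc d)) (f≗f′ 0)) (⋆-congˡ g (f≗f′ ∘ suc) d)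

⋆-congʳ-≤ : ∀ f {g g′ : ℕ → ℕ} d → (∀ {e} → e ≤ d → g e ≡ g′ e) → (f ⋆ g) d ≡ (f ⋆ g′) d
⋆-congʳ-≤ f zero    g≗g′ = cong (f 0 *_) (g≗g′ z≤n)
⋆-congʳ-≤ f (suc d) g≗g′ =
  cong₂ _+_ (cong (f 0 *_) (g≗g′ ≤-refl)) (⋆-congʳ-≤ (f ∘ suc) d (g≗g′ ∘ m≤n⇒m≤1+n))

⋆-congʳ-< : ∀ {f} {g g′ : ℕ → ℕ} d → f 0 ≡ 0 → (∀ {e} → e < d → g e ≡ g′ e) →
            (f ⋆ g) d ≡ (f ⋆ g′) d
⋆-congʳ-< {f} {g} {g′} zero    f0≡0 _ = trans (cong (_* g 0) f0≡0) (sym (cong (_* g′ 0) f0≡0))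
⋆-congʳ-< {f} {g} {g′} (suc d) f0≡0 g≗g′ = cong₂ _+_
  (trans (cong (_* g (suc d)) f0≡0) (sym (cong (_* g′ (suc d)) f0≡0)))
  (⋆-congʳ-≤ (f ∘ suc) d (g≗g′ ∘ s≤s))

0⋆-zero : ∀ g d → ((λ _ → 0) ⋆ g) d ≡ 0
0⋆-zero g zero    = refl
0⋆-zero g (suc d) = 0⋆-zero g d

⋆-distribʳ-+ : ∀ f f′ g d → ((λ e → f e + f′ e) ⋆ g) d ≡ (f ⋆ g) d + (f′ ⋆ g) d
⋆-distribʳ-+ f f′ g zero    = *-distribʳ-+ (g 0) (f 0) (f′ 0)
⋆-distribʳ-+ f f′ g (suc d) = begin
  (f 0 + f′ 0) * g (suc d) + ((λ e → f (suc e) + f′ (suc e)) ⋆ g) d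
    ≡⟨ cong₂ _+_ (*-distribʳ-+ (g (suc d)) (f 0) (f′ 0)) (⋆-distribʳ-+ (f ∘ suc) (f′ ∘ suc) g d) ⟩
  (f 0 * g (suc d) + f′ 0 * g (suc d)) + ((f ∘ suc ⋆ g) d + (f′ ∘ suc ⋆ g) d)
    ≡⟨ interchange (f 0 * g (suc d)) (f′ 0 * g (suc d)) _ _ ⟩
  (f ⋆ g) (suc d) + (f′ ⋆ g) (suc d) ∎
  where open ≡-Reasoning

δ-⋆-< : ∀ k g {d} → d < k → (δ k ⋆ g) d ≡ 0
δ-⋆-< (suc k) g {zero}  _         = refl
δ-⋆-< (suc k) g {suc d} (s≤s d<k) = δ-⋆-< k g d<k

δ-⋆-+ : ∀ k g d → (δ k ⋆ g) (k + d) ≡ g d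
δ-⋆-+ zero    g zero    = +-identityʳ (g 0)
δ-⋆-+ zero    g (suc d) = trans (cong₂ _+_ (+-identityʳ (g (suc d))) (0⋆-zero g d)) (+-identityʳ _)
δ-⋆-+ (suc k) g d       = δ-⋆-+ k g d

renewal-unique : ∀ f (U L L′ : ℕ → ℕ) → f 0 ≡ 0 →
                 (∀ d → L d ≡ U d + (f ⋆ L) d) → (∀ d → L′ d ≡ U d + (f ⋆ L′) d) →
                 ∀ d → L d ≡ L′ d
renewal-unique f U L L′ f0≡0 L-renewal L′-renewal = <-rec (λ d → L d ≡ L′ d) step
  where
  step : ∀ d → (∀ {e} → e < d → L e ≡ L′ e) → L d ≡ L′ d
  step d agree-below = trans (L-renewal d)
    (trans (cong (U d +_) (⋆-congʳ-< d f0≡0 agree-below)) (sym (L′-renewal d)))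

dropZero-node : ∀ {n} (i : Fin n) (u a b : Tree (Fin (suc n))) d →
  let L = λ e → leaves (dropZero u) e i in
  walk (dropZero u) (dropZero a) d i ≡ walk u a d (suc i) + ((λ e → walk u a e zero) ⋆ L) d →
  walk (dropZero u) (dropZero b) d i ≡ walk u b d (suc i) + ((λ e → walk u b e zero) ⋆ L) d →
  walk (dropZero u) (dropZero (node a b)) (suc d) i
    ≡ walk u (node a b) (suc d) (suc i) + ((λ e → walk u (node a b) e zero) ⋆ L) (suc d)
dropZero-node i u a b d a-renewal b-renewal = begin
  walk r (dropZero a) d i + walk r (dropZero b) d i
    ≡⟨ cong₂ _+_ a-renewal b-renewal ⟩
  (Uᵃ + (Zᵃ ⋆ L) d) + (Uᵇ + (Zᵇ ⋆ L) d)
    ≡⟨ interchange Uᵃ _ Uᵇ _ ⟩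
  (Uᵃ + Uᵇ) + ((Zᵃ ⋆ L) d + (Zᵇ ⋆ L) d)
    ≡⟨ cong (Uᵃ + Uᵇ +_) (sym (⋆-distribʳ-+ Zᵃ Zᵇ L d)) ⟩
  (Uᵃ + Uᵇ) + ((λ e → Zᵃ e + Zᵇ e) ⋆ L) d ∎
  where
  open ≡-Reasoning
  r = dropZero u
  L = λ e → leaves r e i
  Uᵃ = walk u a d (suc i)
  Uᵇ = walk u b d (suc i)
  Zᵃ = λ e → walk u a e zero
  Zᵇ = λ e → walk u b e zero

mutual
  walk-dropZero : ∀ {n} (i : Fin n) (u s : Tree (Fin (suc n))) d →
    walk (dropZero u) (dropZero s) d i
      ≡ walk u s d (suc i) + ((λ e → walk u s e zero) ⋆ (λ e → leaves (dropZero u) e i)) d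
  walk-dropZero i u (leaf zero) zero = sym (+-identityʳ _)
  walk-dropZero i u (leaf zero) (suc d) =
    sym (trans (cong₂ _+_ (+-identityʳ _) (0⋆-zero _ d)) (+-identityʳ _))
  walk-dropZero i u (leaf (suc j)) zero    = sym (+-identityʳ _)
  walk-dropZero i u (leaf (suc j)) (suc d) = sym (0⋆-zero _ d)
  walk-dropZero i u back d                 = leaves-dropZero i u d
  walk-dropZero i u (node a b) zero        = refl
  walk-dropZero i u (node a b) (suc d)     =
    dropZero-node i u a b d (walk-dropZero i u a d) (walk-dropZero i u b d)

  -- The renewal equation of FLDR: an output i at depth d either comes from a leaf i of u
  -- or from a restart at a former leaf 0 at some depth e, followed by depth d − e from the root.
  leaves-dropZero : ∀ {n} (i : Fin n) (u : Tree (Fin (suc n))) d →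
    leaves (dropZero u) d i
      ≡ leaves u d (suc i) + ((λ e → leaves u e zero) ⋆ (λ e → leaves (dropZero u) e i)) d
  leaves-dropZero i (leaf zero) zero       = refl
  leaves-dropZero i (leaf zero) (suc d)    = sym (0⋆-zero _ d)
  leaves-dropZero i (leaf (suc j)) zero    = sym (+-identityʳ _)
  leaves-dropZero i (leaf (suc j)) (suc d) = sym (0⋆-zero _ d)
  leaves-dropZero i back d                 = sym (0⋆-zero _ d)
  leaves-dropZero i (node a b) zero        = refl
  leaves-dropZero i (node a b) (suc d)     =
    dropZero-node i (node a b) a b d (walk-dropZero i (node a b) a d) (walk-dropZero i (node a b) b d)

quotient-unique : ∀ x d q .{{_ : NonZero d}} → q * d ≤ x → x < suc q * d → x / d ≡ q
quotient-unique x d q lower upper = ≤-antisym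
  (s≤s⁻¹ (m<n*o⇒m/o<n upper))
  (subst (_≤ x / d) (m*n/n≡m q d) (/-monoˡ-≤ d lower))

c*[r+q*m]/[1+c*m]≡q : ∀ c m q r → q ≤ c * r → r ≤ m → c * (r + q * m) / suc (c * m) ≡ q
c*[r+q*m]/[1+c*m]≡q c m q r q≤cr r≤m = quotient-unique (c * (r + q * m)) (suc (c * m)) q lower upper
  where
  open ≤-Reasoning
  q*[1+c*m]≡q+c*[q*m] : q * suc (c * m) ≡ q + c * (q * m)
  q*[1+c*m]≡q+c*[q*m] = trans (*-suc q (c * m)) (cong (q +_) (x∙yz≈y∙xz q c m))
  lower : q * suc (c * m) ≤ c * (r + q * m)
  lower = begin
    q * suc (c * m)     ≡⟨ q*[1+c*m]≡q+c*[q*m] ⟩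
    q + c * (q * m)     ≤⟨ +-monoˡ-≤ (c * (q * m)) q≤cr ⟩
    c * r + c * (q * m) ≡⟨ *-distribˡ-+ c r (q * m) ⟨
    c * (r + q * m)     ∎
  upper : c * (r + q * m) < suc q * suc (c * m)
  upper = s≤s (begin
    c * (r + q * m)     ≡⟨ *-distribˡ-+ c r (q * m) ⟩
    c * r + c * (q * m) ≤⟨ +-mono-≤ (*-monoʳ-≤ c r≤m) (m≤n+m (c * (q * m)) q) ⟩
    c * m + (q + c * (q * m)) ≡⟨ cong (c * m +_) q*[1+c*m]≡q+c*[q*m] ⟨
    c * m + q * suc (c * m) ∎)

-- For x = D a with D K = 1 + c m, the residue r of x mod m satisfies r K ≡ a (mod m), hence
-- x = D a ≤ D r K = r (1 + c m), which bounds the quotient by c r.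
quotient≤c*remainder : ∀ {m c D K} a .{{_ : NonZero m}} → D * K ≡ suc (c * m) → a < m →
                       (D * a) / m ≤ c * ((D * a) % m)
quotient≤c*remainder {m} {c} {D} {K} a DK≡1+cm a<m =
  *-cancelʳ-≤ q (c * r) m (+-cancelˡ-≤ r (q * m) (c * r * m) (begin
    r + q * m         ≡⟨ m≡m%n+[m/n]*n x m ⟨
    D * a             ≤⟨ *-monoʳ-≤ D a≤r*K ⟩
    D * (r * K)       ≡⟨ x∙yz≈y∙xz D r K ⟩
    r * (D * K)       ≡⟨ cong (r *_) DK≡1+cm ⟩
    r * suc (c * m)   ≡⟨ x*[1+y*z]≡x+y*x*z r c m ⟩
    r + c * r * m     ∎))
  where
  open ≤-Reasoning
  x = D * a
  q = x / m
  r = x % m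
  x*[1+y*z]≡x+y*x*z : ∀ x y z → x * suc (y * z) ≡ x + y * x * z
  x*[1+y*z]≡x+y*x*z = solve-∀
  [x+y*z]*w≡x*w+y*w*z : ∀ x y z w → (x + y * z) * w ≡ x * w + y * w * z
  [x+y*z]*w≡x*w+y*w*z = solve-∀
  x*K≡a+c*a*m : x * K ≡ a + c * a * m
  x*K≡a+c*a*m = trans (*-assoc D a K) (trans (x∙yz≈y∙xz D a K)
    (trans (cong (a *_) DK≡1+cm) (x*[1+y*z]≡x+y*x*z a c m)))
  a≤r*K : a ≤ r * K
  a≤r*K = begin
    a                           ≡⟨ m<n⇒m%n≡m a<m ⟨
    a % m                       ≡⟨ [m+kn]%n≡m%n a (c * a) m ⟨
    (a + c * a * m) % m         ≡⟨ cong (_% m) x*K≡a+c*a*m ⟨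
    (x * K) % m                 ≡⟨ cong (λ y → (y * K) % m) (m≡m%n+[m/n]*n x m) ⟩
    ((r + q * m) * K) % m       ≡⟨ cong (_% m) ([x+y*z]*w≡x*w+y*w*z r q m K) ⟩
    (r * K + q * K * m) % m     ≡⟨ [m+kn]%n≡m%n (r * K) (q * K) m ⟩
    (r * K) % m                 ≤⟨ m%n≤m (r * K) m ⟩
    r * K                       ∎

dyadicDigit : ℕ → ℕ → ℕ → ℕ
dyadicDigit d y k = ε d y (2 ^ k) {{m^n≢0 2 k}}

ε-shift : ∀ d y k → dyadicDigit (suc d) y (suc k) ≡ dyadicDigit d y k
ε-shift d y k = cong (_% 2) (trans (cong (_/ 2 ^ suc k) (*-assoc 2 (2 ^ d) y))
                                  (m*n/m*o≡n/o 2 (2 ^ d * y) (2 ^ k)))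
  where instance
    2^k≢0 = m^n≢0 2 k
    2^[1+k]≢0 = m^n≢0 2 (suc k)

ε-integer : ∀ d y → ε (suc d) y 1 ≡ 0
ε-integer d y = trans (cong (_% 2) (trans (n/1≡n (2 * 2 ^ d * y)) (2*x*y≡x*y*2 (2 ^ d) y)))
                      (m*n%n≡0 (2 ^ d * y) 2)
  where 2*x*y≡x*y*2 : ∀ x y → 2 * x * y ≡ x * y * 2
        2*x*y≡x*y*2 = solve-∀

ε-beyond : ∀ ℓ d y → dyadicDigit (ℓ + suc d) y ℓ ≡ 0
ε-beyond zero    d y = ε-integer d y
ε-beyond (suc ℓ) d y = trans (ε-shift (ℓ + suc d) y ℓ) (ε-beyond ℓ d y)

ε-1/2^ : ∀ ℓ e → dyadicDigit e 1 ℓ ≡ δ ℓ e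
ε-1/2^ zero    zero    = refl
ε-1/2^ zero    (suc e) = ε-integer e 1
ε-1/2^ (suc ℓ) zero    = cong (_% 2) (m<n⇒m/n≡0 {{m^n≢0 2 (suc ℓ)}} (^-monoʳ-< 2 (s≤s (s≤s z≤n)) (s≤s (z≤n {ℓ}))))
ε-1/2^ (suc ℓ) (suc e) = trans (ε-shift e 1 ℓ) (ε-1/2^ ℓ e)

ε-zero : ∀ {m} a .{{_ : NonZero m}} → a < m → ε 0 a m ≡ 0
ε-zero a a<m = cong (_% 2) (m<n⇒m/n≡0 (subst (_< _) (sym (*-identityˡ a)) a<m))

-- Shifting by ℓ adds the even integer 2^(d+1) c a to ⌊2^(d+1) a/m⌋; at digit 0 the added
-- c a may be odd, so the period only starts at digit 1.
ε-periodic : ∀ {m c ℓ} a d .{{_ : NonZero m}} → 2 ^ ℓ ≡ suc (c * m) →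
             ε (ℓ + suc d) a m ≡ ε (suc d) a m
ε-periodic {m} {c} {ℓ} a d 2^ℓ≡1+cm = begin
  2 ^ (ℓ + suc d) * a / m % 2         ≡⟨ cong (λ y → y / m % 2) 2^[ℓ+1+d]*a≡x+k*2*m ⟩
  (x + k * 2 * m) / m % 2             ≡⟨ cong (_% 2) (+-distrib-/-∣ʳ x (n∣m*n (k * 2))) ⟩
  (x / m + k * 2 * m / m) % 2         ≡⟨ cong (λ y → (x / m + y) % 2) (m*n/n≡m (k * 2) m) ⟩
  (x / m + k * 2) % 2                 ≡⟨ [m+kn]%n≡m%n (x / m) k 2 ⟩
  x / m % 2                           ∎
  where
  open ≡-Reasoning
  x = 2 ^ suc d * a
  k = c * (2 ^ d * a)
  expand : ∀ c m p a → suc (c * m) * (2 * p) * a ≡ 2 * p * a + c * (p * a) * 2 * m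
  expand = solve-∀
  2^[ℓ+1+d]*a≡x+k*2*m : 2 ^ (ℓ + suc d) * a ≡ x + k * 2 * m
  2^[ℓ+1+d]*a≡x+k*2*m = trans (cong (_* a) (trans (^-distribˡ-+-* 2 ℓ (suc d)) (cong (_* 2 ^ suc d) 2^ℓ≡1+cm)))
                       (expand c m (2 ^ d) a)

ε-truncate : ∀ {m c ℓ d} a .{{_ : NonZero m}} → 2 ^ ℓ ≡ suc (c * m) → a < m → d ≤ ℓ →
             dyadicDigit d (c * a) ℓ ≡ ε d a m
ε-truncate {m} {c} {ℓ} {d} a 2^ℓ≡1+cm a<m d≤ℓ = cong (_% 2) (begin
  2 ^ d * (c * a) / 2 ^ ℓ              ≡⟨ /-congʳ 2^ℓ≡1+cm ⟩
  2 ^ d * (c * a) / suc (c * m)        ≡⟨ cong (_/ suc (c * m)) (x∙yz≈y∙xz (2 ^ d) c a) ⟩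
  c * x / suc (c * m)                  ≡⟨ cong (λ y → c * y / suc (c * m)) (m≡m%n+[m/n]*n x m) ⟩
  c * (x % m + x / m * m) / suc (c * m) ≡⟨ c*[r+q*m]/[1+c*m]≡q c m (x / m) (x % m) q≤cr (<⇒≤ (m%n<n x m)) ⟩
  x / m                                ∎)
  where
  open ≡-Reasoning
  instance 2^ℓ≢0 = m^n≢0 2 ℓ
  x = 2 ^ d * a
  2^d*2^[ℓ∸d]≡1+cm : 2 ^ d * 2 ^ (ℓ ∸ d) ≡ suc (c * m)
  2^d*2^[ℓ∸d]≡1+cm = trans (sym (^-distribˡ-+-* 2 d (ℓ ∸ d))) (trans (cong (2 ^_) (m+[n∸m]≡n d≤ℓ)) 2^ℓ≡1+cm)
  q≤cr : x / m ≤ c * (x % m)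
  q≤cr = quotient≤c*remainder {m} {c} {2 ^ d} a 2^d*2^[ℓ∸d]≡1+cm a<m

split-at : ∀ {p} {P : ℕ → Set p} ℓ → (∀ {d} → d < ℓ → P d) → (∀ k → P (ℓ + k)) → ∀ d → P d
split-at {P = P} ℓ below beyond d with d <? ℓ
... | yes d<ℓ = below d<ℓ
... | no  d≮ℓ = subst P (m+[n∸m]≡n (≮⇒≥ d≮ℓ)) (beyond (d ∸ ℓ))

ε-renewal : ∀ {m c ℓ} a .{{_ : NonZero m}} → 1 ≤ ℓ → 2 ^ ℓ ≡ suc (c * m) → a < m →
            ∀ d → ε d a m ≡ dyadicDigit d (c * a) ℓ + (δ ℓ ⋆ (λ e → ε e a m)) d
ε-renewal {m} {c} {ℓ} a 1≤ℓ 2^ℓ≡1+cm a<m = split-at ℓ below beyond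
  where
  A = λ e → ε e a m
  below : ∀ {d} → d < ℓ → ε d a m ≡ dyadicDigit d (c * a) ℓ + (δ ℓ ⋆ A) d
  below {d} d<ℓ = sym (trans (cong (dyadicDigit d (c * a) ℓ +_) (δ-⋆-< ℓ A d<ℓ))
    (trans (+-identityʳ _) (ε-truncate {c = c} a 2^ℓ≡1+cm a<m (<⇒≤ d<ℓ))))
  digits : ∀ k → ε (ℓ + k) a m ≡ dyadicDigit (ℓ + k) (c * a) ℓ + ε k a m
  digits zero = sym (trans
    (cong₂ _+_ (ε-truncate {c = c} a 2^ℓ≡1+cm a<m (≤-reflexive (+-identityʳ ℓ))) (ε-zero a a<m))
    (+-identityʳ _))
  digits (suc k) = trans (ε-periodic {c = c} {ℓ} a k 2^ℓ≡1+cm) (sym (cong (_+ ε (suc k) a m) (ε-beyond ℓ k (c * a))))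
  beyond : ∀ k → ε (ℓ + k) a m ≡ dyadicDigit (ℓ + k) (c * a) ℓ + (δ ℓ ⋆ A) (ℓ + k)
  beyond k = trans (digits k) (cong (dyadicDigit (ℓ + k) (c * a) ℓ +_) (sym (δ-⋆-+ ℓ A k)))

dropZero-optimal : ∀ {n} (x : Fin n → ℕ) {m c ℓ} .{{_ : NonZero m}} →
                   1 ≤ ℓ → 2 ^ ℓ ≡ suc (c * m) → (∀ i → x i < m) →
                   (u : Tree (Fin (suc n))) →
                   (∀ d → leaves u d zero ≡ dyadicDigit d 1 ℓ) →
                   (∀ d i → leaves u d (suc i) ≡ dyadicDigit d (c * x i) ℓ) →
                   EntropyOptimal (dropZero u) x m
dropZero-optimal x {m} {c} {ℓ} 1≤ℓ 2^ℓ≡1+cm x<m u u-zero u-suc d i =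
  renewal-unique (δ ℓ) (λ e → dyadicDigit e (c * x i) ℓ) L (λ e → ε e (x i) m) (δ-< 1≤ℓ)
    L-renewal (ε-renewal {c = c} (x i) 1≤ℓ 2^ℓ≡1+cm (x<m i)) d
  where
  L = λ e → leaves (dropZero u) e i
  L-renewal : ∀ d → L d ≡ dyadicDigit d (c * x i) ℓ + (δ ℓ ⋆ L) d
  L-renewal d = trans (leaves-dropZero i u d)
    (cong₂ _+_ (u-suc d i) (⋆-congˡ L (λ e → trans (u-zero e) (ε-1/2^ ℓ e)) d))

⌈log₂[1+2^n]⌉≡1+n : ∀ n → ⌈log₂ suc (2 ^ n) ⌉ ≡ suc n
⌈log₂[1+2^n]⌉≡1+n zero    = refl
⌈log₂[1+2^n]⌉≡1+n (suc n) = ∸1≡⇒≡suc (trans (sym (⌈log₂⌈n/2⌉⌉≡⌈log₂n⌉∸1 (suc (2 ^ suc n))))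
                                              (trans (cong ⌈log₂_⌉ halve) (⌈log₂[1+2^n]⌉≡1+n n)))
  where
  halve : ⌈ suc (2 ^ suc n) /2⌉ ≡ suc (2 ^ n)
  halve = cong suc (trans (cong (λ k → ⌊ 2 ^ n + k /2⌋) (+-identityʳ (2 ^ n))) (sym (n≡⌊n+n/2⌋ (2 ^ n))))
  ∸1≡⇒≡suc : ∀ {x y} → x ∸ 1 ≡ suc y → x ≡ suc (suc y)
  ∸1≡⇒≡suc {suc x} x∸1≡1+y = cong suc x∸1≡1+y

⌈log₂[2^ℓ∸1]⌉≡ℓ : ∀ {ℓ M} → 2 ≤ ℓ → suc M ≡ 2 ^ ℓ → ⌈log₂ M ⌉ ≡ ℓ
⌈log₂[2^ℓ∸1]⌉≡ℓ {suc (suc j)} {M} (s≤s (s≤s _)) 1+M≡2^ℓ = ≤-antisym upper lower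
  where
  open ≤-Reasoning
  p = 2 ^ suc j
  upper : ⌈log₂ M ⌉ ≤ suc (suc j)
  upper = begin
    ⌈log₂ M ⌉                 ≤⟨ ⌈log₂⌉-mono-≤ (subst (M ≤_) 1+M≡2^ℓ (n≤1+n M)) ⟩
    ⌈log₂ 2 ^ suc (suc j) ⌉   ≡⟨ ⌈log₂2^n⌉≡n (suc (suc j)) ⟩
    suc (suc j)               ∎
  1+p≤M : suc p ≤ M
  1+p≤M = s≤s⁻¹ (begin
    suc (suc p)   ≡⟨ +-comm 2 p ⟩
    p + 2         ≤⟨ +-monoʳ-≤ p (subst (2 ≤_) (sym (+-identityʳ p)) (*-monoʳ-≤ 2 (m^n>0 2 j))) ⟩
    p + (p + 0)   ≡⟨ 1+M≡2^ℓ ⟨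
    suc M         ∎)
  lower : suc (suc j) ≤ ⌈log₂ M ⌉
  lower = begin
    suc (suc j)       ≡⟨ ⌈log₂[1+2^n]⌉≡1+n (suc j) ⟨
    ⌈log₂ suc p ⌉     ≤⟨ ⌈log₂⌉-mono-≤ 1+p≤M ⟩
    ⌈log₂ M ⌉         ∎

*-distribˡ-sumF : ∀ n c (f : Fin n → ℕ) → sumF n (λ i → c * f i) ≡ c * sumF n f
*-distribˡ-sumF zero    c f = sym (*-zeroʳ c)
*-distribˡ-sumF (suc n) c f =
  trans (cong (c * f zero +_) (*-distribˡ-sumF n c (f ∘ suc))) (sym (*-distribˡ-+ c (f zero) _))

≤-sumF : ∀ n (f : Fin n → ℕ) i → f i ≤ sumF n f
≤-sumF (suc n) f zero    = m≤m+n (f zero) _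
≤-sumF (suc n) f (suc i) = ≤-trans (≤-sumF n (f ∘ suc) i) (m≤n+m _ (f zero))

-- With a single entry the gcd would be the sum itself.
entry<sumF : ∀ n (a : Fin n → ℕ) → (∀ i → 1 ≤ a i) → gcdF n a ≡ 1 → 1 < sumF n a →
             ∀ i → a i < sumF n a
entry<sumF (suc zero) a _ gcd≡1 1<m zero =
  contradiction (subst (λ z → 1 < z + 0) (trans (sym (gcd-identityʳ (a zero))) gcd≡1) 1<m) (<-irrefl refl)
entry<sumF (suc (suc n)) a a≥1 _ _ zero    = m<m+n (a zero) (≤-trans (a≥1 (suc zero)) (≤-sumF (suc n) (a ∘ suc) zero))
entry<sumF (suc (suc n)) a a≥1 _ _ (suc i) = +-mono-≤ (a≥1 zero) (≤-sumF (suc n) (a ∘ suc) i)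

order≥2 : ∀ {m ℓ} → 1 < m → IsMultOrder2 m ℓ → 2 ≤ ℓ
order≥2 {ℓ = zero}                          _ (() , _)
order≥2 {suc zero}            {suc zero}    (s≤s ())
order≥2 {suc (suc zero)}      {suc zero}    _ (_ , () , _)
order≥2 {suc (suc (suc m))}   {suc zero}    _ (_ , () , _)
order≥2 {ℓ = suc (suc ℓ)}                  _ _ = s≤s (s≤s z≤n)

order⇒2^ℓ≡1+c*m : ∀ {m ℓ} → 1 < m → IsMultOrder2 m ℓ → 2 ^ ℓ ≡ suc (2 ^ ℓ / suc (m ∸ 1) * m)
order⇒2^ℓ≡1+c*m {m} {ℓ} 1<m (_ , 2^ℓ≡1 , _) = begin
  2 ^ ℓ                     ≡⟨ m≡m%n+[m/n]*n (2 ^ ℓ) m′ ⟩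
  2 ^ ℓ % m′ + c * m′       ≡⟨ cong (_+ c * m′) (trans 2^ℓ≡1 (m<n⇒m%n≡m (subst (1 <_) (sym m′≡m) 1<m))) ⟩
  suc (c * m′)              ≡⟨ cong (λ k → suc (c * k)) m′≡m ⟩
  suc (c * m)               ∎
  where
  open ≡-Reasoning
  m′ = suc (m ∸ 1)
  c = 2 ^ ℓ / m′
  m′≡m : m′ ≡ m
  m′≡m = m+[n∸m]≡n (<⇒≤ 1<m)

fldr-entropy-optimal : ∀ n (x : Fin n → ℕ) c ℓ .{{_ : NonZero (sumF n x)}} →
                       2 ≤ ℓ → 2 ^ ℓ ≡ suc (c * sumF n x) → (∀ i → x i < sumF n x) →
                       (t : Tree (Fin n)) → IsFLDR n (λ i → c * x i) t →
                       EntropyOptimal t x (sumF n x)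
fldr-entropy-optimal n x c ℓ 2≤ℓ 2^ℓ≡1+cm x<m t (u , u-opt , refl) =
  dropZero-optimal x {c = c} {ℓ} (<⇒≤ 2≤ℓ) 2^ℓ≡1+cm x<m u u-zero u-suc
  where
  open ≡-Reasoning
  m = sumF n x
  A = λ i → c * x i
  M≡cm : fldrM n A ≡ c * m
  M≡cm = *-distribˡ-sumF n c x
  K≡ℓ : fldrK n A ≡ ℓ
  K≡ℓ = trans (cong ⌈log₂_⌉ M≡cm) (⌈log₂[2^ℓ∸1]⌉≡ℓ 2≤ℓ (sym 2^ℓ≡1+cm))
  A₀≡1 : fldrQ n A zero ≡ 1
  A₀≡1 = begin
    2 ^ fldrK n A ∸ fldrM n A   ≡⟨ cong₂ (λ K M → 2 ^ K ∸ M) K≡ℓ M≡cm ⟩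
    2 ^ ℓ ∸ c * m               ≡⟨ cong (_∸ c * m) 2^ℓ≡1+cm ⟩
    suc (c * m) ∸ c * m         ≡⟨ m+n∸n≡m 1 (c * m) ⟩
    1                           ∎
  u-zero : ∀ d → leaves u d zero ≡ dyadicDigit d 1 ℓ
  u-zero d = trans (u-opt d zero) (cong₂ (dyadicDigit d) A₀≡1 K≡ℓ)
  u-suc : ∀ d i → leaves u d (suc i) ≡ dyadicDigit d (c * x i) ℓ
  u-suc d i = trans (u-opt d (suc i)) (cong (dyadicDigit d (c * x i)) K≡ℓ)

corollary5p8 : (n : ℕ) (a : Fin n → ℕ) (ℓ : ℕ)
    → (∀ i → 1 ≤ a i)
    → gcdF n a ≡ 1
    → (m>1 : 1 < sumF n a)
    → sumF n a % 2 ≡ 1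
    → IsMultOrder2 (sumF n a) ℓ
    → (t : Tree (Fin n))
    → IsALDR n a ℓ t
    → EntropyOptimal t a (sumF n a) {{>-nonZero (<-trans (s≤s z≤n) m>1)}}
corollary5p8 n a ℓ a≥1 gcd≡1 m>1 _ ord =
  fldr-entropy-optimal n a (2 ^ ℓ / suc (sumF n a ∸ 1)) ℓ {{>-nonZero (<-trans (s≤s z≤n) m>1)}}
    (order≥2 m>1 ord) (order⇒2^ℓ≡1+c*m m>1 ord) (entry<sumF n a a≥1 gcd≡1 m>1)
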